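{- Let $G$ be a finite graph and let $r$ and $s$ be two crossing clique separations of $G$ with $|r|\le|s|$. Then there are orientations $\vec r$ and $\vec s$ of $r$ and $s$ such that $\overleftarrow r\wedge\overleftarrow s$, $\overleftarrow r\wedge\vec s$ and $\vec r\wedge\overleftarrow s$ are clique separations with $|\overleftarrow r\wedge\overleftarrow s|\le|r|$, $|\overleftarrow r\wedge\vec s|\le|r|$ and $|\vec r\wedge\overleftarrow s|\le|s|$. Moreover, if $|\overleftarrow r\wedge\overleftarrow s|=|r|=|s|$, then $\vec r\wedge\vec s$ is also a clique separation with $|\vec r\wedge\vec s|\le|r|$.
   Context: A separation of $G=(V,E)$ is a pair $(A,B)$ with $A\cup B=V$ and no edge between $A\setminus B$ and $B\setminus A$; its inverse is $(B,A)$, its order is $|(A,B)|=|A\cap B|$ (and $|s|$ is the order of either orientation of $s$), and $(A,B)\le(C,D)$ iff $A\subseteq C$ and $B\supseteq D$, with $(A,B)\wedge(C,D)=(A\cap C,B\cup D)$. It is a clique separation if $G[A\cap B]$ is a complete graph. Two separations cross if no orientations of them are comparable, i.e. they are not nested. -}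

module Defs where

open import Data.Nat using (ℕ; _≤_)
open import Data.Bool using (Bool; true; false)
open import Data.Fin using (Fin)
open import Data.Fin.Subset using (Subset; _∈_; _∉_; _⊆_; _∩_; _∪_; ∣_∣; ⊤)
open import Data.Product using (_×_; _,_; proj₁; proj₂)
open import Data.Sum using (_⊎_)
open import Relation.Binary.PropositionalEquality using (_≡_; _≢_)
open import Relation.Nullary using (¬_)

record Graph (n : ℕ) : Set where
  field
    adj     : Fin n → Fin n → Bool
    adj-sym : ∀ u v → adj u v ≡ adj v u
    adj-irr : ∀ u → adj u u ≡ false

open Graph public

Adj : ∀ {n} → Graph n → Fin n → Fin n → Set
Adj G u v = adj G u v ≡ true

-- An (oriented) separation candidate: a pair (A , B) of vertex sets.
Sep : ℕ → Set
Sep n = Subset n × Subset n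

IsSeparation : ∀ {n} → Graph n → Sep n → Set
IsSeparation {n} G (A , B) =
  (A ∪ B ≡ ⊤) ×
  (∀ (u v : Fin n) → u ∈ A → u ∉ B → v ∈ B → v ∉ A → ¬ Adj G u v)

_⁻¹ : ∀ {n} → Sep n → Sep n
(A , B) ⁻¹ = (B , A)

order : ∀ {n} → Sep n → ℕ
order (A , B) = ∣ A ∩ B ∣

_≤ₛ_ : ∀ {n} → Sep n → Sep n → Set
(A , B) ≤ₛ (C , D) = (A ⊆ C) × (D ⊆ B)

_∧_ : ∀ {n} → Sep n → Sep n → Sep n
(A , B) ∧ (C , D) = (A ∩ C , B ∪ D)

IsClique : ∀ {n} → Graph n → Subset n → Set
IsClique {n} G X = ∀ (u v : Fin n) → u ∈ X → v ∈ X → u ≢ v → Adj G u v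

IsCliqueSeparation : ∀ {n} → Graph n → Sep n → Set
IsCliqueSeparation G (A , B) = IsSeparation G (A , B) × IsClique G (A ∩ B)

-- r' is an orientation of (the unoriented separation represented by) r
IsOrientation : ∀ {n} → Sep n → Sep n → Set
IsOrientation r r' = (r' ≡ r) ⊎ (r' ≡ r ⁻¹)

-- r and s cross: no orientation of r is comparable with any orientation of s
-- (comparability in either direction covered by ranging over all orientations
-- of both sides, since r ≤ s iff s⁻¹ ≤ r⁻¹).
Cross : ∀ {n} → Sep n → Sep n → Set
Cross r s = ∀ r' s' → IsOrientation r r' → IsOrientation s s' →
            ¬ (r' ≤ₛ s') × ¬ (s' ≤ₛ r')

module Submission where

-- Write r⃗ = (A , B), s⃗ = (C , D) and call A ∩ B, C ∩ D their separators.
-- The separator of a corner (P , P') ∧ (Q , Q') consists of vertices of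
-- P ∩ Q lying in P' or in Q'; hence it is contained in the separator of
-- (P , P') as soon as the separator of (Q , Q') lies in P', and
-- symmetrically.  Since a clique never meets both A ∖ B and B ∖ A, every
-- clique separator lies on one side of the other separation; so we can
-- orient r and s such that each separator lies on the first side of the
-- other oriented separation ("docked" orientations).  For docked
-- orientations the three corners r⃗⁻¹ ∧ s⃗⁻¹, r⃗⁻¹ ∧ s⃗, r⃗ ∧ s⃗⁻¹ have
-- separators inside A ∩ B resp. C ∩ D; corners of separations are
-- separations and subsets of cliques are cliques, which gives the claims.
-- If the first corner has order |r| its separator equals A ∩ B, which
-- forces A ∩ B ⊆ C ∩ D and thereby bounds the fourth corner r⃗ ∧ s⃗.

open import Defs
open import Data.Nat using (ℕ; _≤_)
import Data.Nat.Properties as ℕ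
open import Data.Product using (_×_; Σ-syntax; _,_; proj₁)
open import Data.Sum using (_⊎_; inj₁; inj₂)
open import Data.Fin using (Fin)
open import Data.Fin.Properties using (any?)
open import Data.Fin.Subset using (Subset; _∈_; _∉_; _⊆_; _∩_; _∪_; ∣_∣; ⊤)
open import Data.Fin.Subset.Properties
  using (_∈?_; ∈⊤; ⊆⊤; ⊆-antisym; ⊆-trans; p∩q⊆q; ∪-comm; p⊆q⇒∣p∣≤∣q∣; p⊂q⇒∣p∣<∣q∣;
         x∈p∩q⁺; x∈p∩q⁻; x∈p∪q⁺; x∈p∪q⁻)
open import Relation.Binary.PropositionalEquality using (_≡_; refl; sym; trans; subst; subst₂)
open import Relation.Nullary using (¬_; yes; no; contradiction)
open import Relation.Nullary.Decidable using (_×-dec_; ¬?; decidable-stable)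

private
  variable
    n : ℕ
    x : Fin n
    P P' Q Q' : Subset n

everything⇒⊤ : {p : Subset n} → (∀ x → x ∈ p) → p ≡ ⊤
everything⇒⊤ all∈ = ⊆-antisym ⊆⊤ (λ {x} _ → all∈ x)

outside-right : P ∪ P' ≡ ⊤ → x ∉ P' → x ∈ P
outside-right {P = P} {P'} {x = x} cov x∉P'
  with x∈p∪q⁻ P P' (subst (x ∈_) (sym cov) ∈⊤)
... | inj₁ x∈P  = x∈P
... | inj₂ x∈P' = contradiction x∈P' x∉P'

outside-left : P ∪ P' ≡ ⊤ → x ∉ P → x ∈ P'
outside-left {P = P} {P'} cov = outside-right (trans (∪-comm P' P) cov)

⊆-same-size : {p q : Subset n} → p ⊆ q → ∣ p ∣ ≡ ∣ q ∣ → q ⊆ p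
⊆-same-size {p = p} p⊆q |p|≡|q| {x} x∈q with x ∈? p
... | yes x∈p = x∈p
... | no  x∉p = contradiction |p|≡|q|
                  (ℕ.<⇒≢ (p⊂q⇒∣p∣<∣q∣ (p⊆q , x , x∈q , x∉p)))

separator : Sep n → Subset n
separator (A , B) = A ∩ B

separator-⁻¹ : (t : Sep n) → separator (t ⁻¹) ⊆ separator t
separator-⁻¹ (A , B) x∈BA with x∈p∩q⁻ B A x∈BA
... | x∈B , x∈A = x∈p∩q⁺ (x∈A , x∈B)

separator-orientation : {t t⃗ : Sep n} → IsOrientation t t⃗ → separator t⃗ ⊆ separator t
separator-orientation (inj₁ refl) = λ x∈ → x∈
separator-orientation {t = t} (inj₂ refl) = separator-⁻¹ t

order-orientation : {t t⃗ : Sep n} → IsOrientation t t⃗ → order t⃗ ≡ order t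
order-orientation o = ℕ.≤-antisym
  (p⊆q⇒∣p∣≤∣q∣ (separator-orientation o))
  (p⊆q⇒∣p∣≤∣q∣ (separator-orientation (inverse-orientation o)))
  where
  inverse-orientation : {t t⃗ : Sep n} → IsOrientation t t⃗ → IsOrientation t⃗ t
  inverse-orientation (inj₁ refl) = inj₁ refl
  inverse-orientation (inj₂ refl) = inj₂ refl

⁻¹-separation : (G : Graph n) {t : Sep n} → IsSeparation G t → IsSeparation G (t ⁻¹)
⁻¹-separation G {A , B} (cov , no-edge) =
  trans (∪-comm B A) cov ,
  λ u v u∈B u∉A v∈A v∉B uv →
    no-edge v u v∈A v∉B u∈B u∉A (subst (_≡ _) (adj-sym G u v) uv)

orientation-separation : (G : Graph n) {t t⃗ : Sep n} → IsOrientation t t⃗ →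
  IsSeparation G t → IsSeparation G t⃗
orientation-separation G (inj₁ refl) sep = sep
orientation-separation G (inj₂ refl) sep = ⁻¹-separation G sep

-- The corner p ∧ q of two separations is a separation: an edge from
-- P ∩ Q ∖ (P' ∪ Q') leaving P ∩ Q would leave P or Q, crossing p or q.
∧-separation : (G : Graph n) → IsSeparation G (P , P') → IsSeparation G (Q , Q') →
  IsSeparation G ((P , P') ∧ (Q , Q'))
∧-separation {n} {P} {P'} {Q} {Q'} G (covP , no-edgeP) (covQ , no-edgeQ) =
  everything⇒⊤ covered , no-edge
  where
  covered : ∀ x → x ∈ (P ∩ Q) ∪ (P' ∪ Q')
  covered x with x ∈? P' | x ∈? Q'
  ... | yes x∈P' | _        = x∈p∪q⁺ (inj₂ (x∈p∪q⁺ (inj₁ x∈P')))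
  ... | no  _    | yes x∈Q' = x∈p∪q⁺ (inj₂ (x∈p∪q⁺ (inj₂ x∈Q')))
  ... | no  x∉P' | no  x∉Q' =
    x∈p∪q⁺ (inj₁ (x∈p∩q⁺ (outside-right covP x∉P' , outside-right covQ x∉Q')))

  no-edge : ∀ (u v : Fin n) → u ∈ P ∩ Q → u ∉ P' ∪ Q' →
            v ∈ P' ∪ Q' → v ∉ P ∩ Q → ¬ Adj G u v
  no-edge u v u∈PQ u∉P'Q' _ v∉PQ uv with x∈p∩q⁻ P Q u∈PQ | v ∈? P
  ... | u∈P , u∈Q | no v∉P =
    no-edgeP u v u∈P (λ u∈P' → u∉P'Q' (x∈p∪q⁺ (inj₁ u∈P')))
             (outside-left covP v∉P) v∉P uv
  ... | u∈P , u∈Q | yes v∈P =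
    no-edgeQ u v u∈Q (λ u∈Q' → u∉P'Q' (x∈p∪q⁺ (inj₂ u∈Q')))
             (outside-left covQ v∉Q) v∉Q uv
    where
    v∉Q : v ∉ Q
    v∉Q v∈Q = v∉PQ (x∈p∩q⁺ (v∈P , v∈Q))

∧-separator : x ∈ separator ((P , P') ∧ (Q , Q')) →
  (x ∈ P × x ∈ Q) × (x ∈ P' ⊎ x ∈ Q')
∧-separator {P = P} {P'} {Q} {Q'} x∈ with x∈p∩q⁻ (P ∩ Q) (P' ∪ Q') x∈
... | x∈PQ , x∈P'Q' = x∈p∩q⁻ P Q x∈PQ , x∈p∪q⁻ P' Q' x∈P'Q'

∧-separator-⊆ˡ : separator (Q , Q') ⊆ P' →
  separator ((P , P') ∧ (Q , Q')) ⊆ separator (P , P')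
∧-separator-⊆ˡ sepQ⊆P' x∈ with ∧-separator x∈
... | (x∈P , _)   , inj₁ x∈P' = x∈p∩q⁺ (x∈P , x∈P')
... | (x∈P , x∈Q) , inj₂ x∈Q' = x∈p∩q⁺ (x∈P , sepQ⊆P' (x∈p∩q⁺ (x∈Q , x∈Q')))

∧-separator-⊆ʳ : separator (P , P') ⊆ Q' →
  separator ((P , P') ∧ (Q , Q')) ⊆ separator (Q , Q')
∧-separator-⊆ʳ sepP⊆Q' x∈ with ∧-separator x∈
... | (x∈P , x∈Q) , inj₁ x∈P' = x∈p∩q⁺ (x∈Q , sepP⊆Q' (x∈p∩q⁺ (x∈P , x∈P')))
... | (_ , x∈Q)   , inj₂ x∈Q' = x∈p∩q⁺ (x∈Q , x∈Q')

clique-⊆ : (G : Graph n) {X S : Subset n} → IsClique G X → S ⊆ X → IsClique G S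
clique-⊆ G clique S⊆X u v u∈S v∈S u≢v = clique u v (S⊆X u∈S) (S⊆X v∈S) u≢v

-- A clique lies entirely on one side of a separation: a vertex of the
-- clique outside C lies in D ∖ C, and every clique vertex in C ∖ D would
-- be adjacent to it.
clique-side : (G : Graph n) {X C D : Subset n} → IsClique G X →
  IsSeparation G (C , D) → X ⊆ C ⊎ X ⊆ D
clique-side G {X} {C} {D} clique (cov , no-edge)
  with any? (λ u → (u ∈? X) ×-dec ¬? (u ∈? C))
... | no none = inj₁ λ {u} u∈X →
  decidable-stable (u ∈? C) (λ u∉C → none (u , u∈X , u∉C))
... | yes (w , w∈X , w∉C) = inj₂ λ {u} u∈X → decidable-stable (u ∈? D) λ u∉D →
  let u∈C = outside-right cov u∉D
  in no-edge u w u∈C u∉D (outside-left cov w∉C) w∉C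
       (clique u w u∈X w∈X (λ { refl → w∉C u∈C }))

corner-in-clique : (G : Graph n) {p q : Sep n} {K : Subset n} →
  IsSeparation G p → IsSeparation G q → IsClique G K → separator (p ∧ q) ⊆ K →
  IsCliqueSeparation G (p ∧ q)
corner-in-clique G {_ , _} {_ , _} sep-p sep-q clique sep⊆K =
  ∧-separation G sep-p sep-q , clique-⊆ G clique sep⊆K

CornerBounds : Graph n → Sep n → Sep n → ℕ → ℕ → Set
CornerBounds G r⃗ s⃗ k l =
  IsCliqueSeparation G ((r⃗ ⁻¹) ∧ (s⃗ ⁻¹)) ×
  IsCliqueSeparation G ((r⃗ ⁻¹) ∧ s⃗) ×
  IsCliqueSeparation G (r⃗ ∧ (s⃗ ⁻¹)) ×
  order ((r⃗ ⁻¹) ∧ (s⃗ ⁻¹)) ≤ k ×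
  order ((r⃗ ⁻¹) ∧ s⃗) ≤ k ×
  order (r⃗ ∧ (s⃗ ⁻¹)) ≤ l ×
  ((order ((r⃗ ⁻¹) ∧ (s⃗ ⁻¹)) ≡ k) → (k ≡ l) →
    IsCliqueSeparation G (r⃗ ∧ s⃗) × (order (r⃗ ∧ s⃗) ≤ k))

orientation-clique-separation : (G : Graph n) {t t⃗ : Sep n} → IsOrientation t t⃗ →
  IsCliqueSeparation G t → IsCliqueSeparation G t⃗
orientation-clique-separation G {_ , _} {_ , _} o (sep , clique) =
  orientation-separation G o sep , clique-⊆ G clique (separator-orientation o)

docked-corners : (G : Graph n) (r⃗ s⃗ : Sep n) →
  IsCliqueSeparation G r⃗ → IsCliqueSeparation G s⃗ →
  separator r⃗ ⊆ proj₁ s⃗ → separator s⃗ ⊆ proj₁ r⃗ →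
  CornerBounds G r⃗ s⃗ (order r⃗) (order s⃗)
docked-corners G (A , B) (C , D) (sep-r , clique-r) (sep-s , clique-s) r⊆C s⊆A =
  corner-in-clique G sep-r⁻¹ sep-s⁻¹ clique-r both⊆r ,
  corner-in-clique G sep-r⁻¹ sep-s   clique-r back⊆r ,
  corner-in-clique G sep-r   sep-s⁻¹ clique-s front⊆s ,
  p⊆q⇒∣p∣≤∣q∣ both⊆r , p⊆q⇒∣p∣≤∣q∣ back⊆r , p⊆q⇒∣p∣≤∣q∣ front⊆s ,
  λ |both|≡|r| |r|≡|s| →
    let r⊆s   = ⊆-trans (⊆-same-size both⊆r |both|≡|r|) both⊆s
        ahead⊆s : separator ((A , B) ∧ (C , D)) ⊆ C ∩ D
        ahead⊆s = ∧-separator-⊆ʳ (⊆-trans r⊆s (p∩q⊆q C D))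
    in corner-in-clique G sep-r sep-s clique-s ahead⊆s ,
       subst (order ((A , B) ∧ (C , D)) ≤_) (sym |r|≡|s|) (p⊆q⇒∣p∣≤∣q∣ ahead⊆s)
  where
  sep-r⁻¹ = ⁻¹-separation G sep-r
  sep-s⁻¹ = ⁻¹-separation G sep-s

  both⊆r : separator ((B , A) ∧ (D , C)) ⊆ A ∩ B
  both⊆r = ⊆-trans (∧-separator-⊆ˡ (⊆-trans (separator-⁻¹ (C , D)) s⊆A))
                   (separator-⁻¹ (A , B))

  both⊆s : separator ((B , A) ∧ (D , C)) ⊆ C ∩ D
  both⊆s = ⊆-trans (∧-separator-⊆ʳ (⊆-trans (separator-⁻¹ (A , B)) r⊆C))
                   (separator-⁻¹ (C , D))

  back⊆r : separator ((B , A) ∧ (C , D)) ⊆ A ∩ B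
  back⊆r = ⊆-trans (∧-separator-⊆ˡ s⊆A) (separator-⁻¹ (A , B))

  front⊆s : separator ((A , B) ∧ (D , C)) ⊆ C ∩ D
  front⊆s = ⊆-trans (∧-separator-⊆ʳ r⊆C) (separator-⁻¹ (C , D))

orient-towards : (G : Graph n) (t : Sep n) {X : Subset n} → IsClique G X →
  IsSeparation G t → Σ[ t⃗ ∈ Sep n ] (IsOrientation t t⃗ × X ⊆ proj₁ t⃗)
orient-towards G (C , D) clique sep with clique-side G clique sep
... | inj₁ X⊆C = (C , D) , inj₁ refl , X⊆C
... | inj₂ X⊆D = (D , C) , inj₂ refl , X⊆D

-- Orient r and s towards each other's separators; the docked corners
-- lemma then gives the claim, since orientation does not change orders.
lemma12 : ∀ {n} (G : Graph n) (r s : Sep n) →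
    IsCliqueSeparation G r → IsCliqueSeparation G s →
    Cross r s → order r ≤ order s →
    Σ[ r⃗ ∈ Sep n ] Σ[ s⃗ ∈ Sep n ]
    (IsOrientation r r⃗ × IsOrientation s s⃗ ×
    IsCliqueSeparation G ((r⃗ ⁻¹) ∧ (s⃗ ⁻¹)) ×
    IsCliqueSeparation G ((r⃗ ⁻¹) ∧ s⃗) ×
    IsCliqueSeparation G (r⃗ ∧ (s⃗ ⁻¹)) ×
    order ((r⃗ ⁻¹) ∧ (s⃗ ⁻¹)) ≤ order r ×
    order ((r⃗ ⁻¹) ∧ s⃗) ≤ order r ×
    order (r⃗ ∧ (s⃗ ⁻¹)) ≤ order s ×
    ((order ((r⃗ ⁻¹) ∧ (s⃗ ⁻¹)) ≡ order r) → (order r ≡ order s) →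
    IsCliqueSeparation G (r⃗ ∧ s⃗) × (order (r⃗ ∧ s⃗) ≤ order r)))
lemma12 G r s (sep-r , clique-r) (sep-s , clique-s) _ _
  with orient-towards G r clique-s sep-r | orient-towards G s clique-r sep-s
... | r⃗ , r-or , s⊆r⃗ | s⃗ , s-or , r⊆s⃗ =
  r⃗ , s⃗ , r-or , s-or ,
  subst₂ (CornerBounds G r⃗ s⃗) (order-orientation r-or) (order-orientation s-or)
    (docked-corners G r⃗ s⃗ (orientation-clique-separation G r-or (sep-r , clique-r))
                          (orientation-clique-separation G s-or (sep-s , clique-s))
      (⊆-trans (separator-orientation r-or) r⊆s⃗)
      (⊆-trans (separator-orientation s-or) s⊆r⃗))
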